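{- Let $H$ be a graph and let $l$ be an intersecting supermodular weakly subadditive integer-valued function on subsets of $V(H)$. If $H$ is minimally $l$-partition-connected, then $|E(H)|=\sum_{v\in V(H)}l(v)-l(H)$.
   Context: Graphs are finite, loopless, and may have multiple edges. $l(\emptyset)=0$, $l(H)=l(V(H))$, $l(v)=l(\{v\})$. $l$ is intersecting supermodular if $l(A\cap B)+l(A\cup B)\ge l(A)+l(B)$ whenever $A\cap B\neq\emptyset$; weakly subadditive if $\sum_{v\in A}l(v)\ge l(A)$ for all $A$. For a partition $P$ of $V(K)$, $e_K(P)$ is the number of edges joining different parts; $K$ is $l$-partition-connected if $e_K(P)\ge\sum_{A\in P}l(A)-l(V(K))$ for every partition $P$, and minimally $l$-partition-connected if in addition $K-e$ is not $l$-partition-connected for every edge $e$. -}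

module Defs where

open import Data.Nat using (ℕ; zero; suc)
open import Data.Integer using (ℤ; +_; _+_; _-_; _≤_)
open import Data.Fin using (Fin)
open import Data.Fin.Subset using (Subset; ⁅_⁆; _∩_; _∪_; Nonempty; ⊤)
open import Data.Fin.Subset using () renaming (⊥ to ∅)
open import Data.Bool using (Bool; true; false; if_then_else_)
open import Data.List using (List; []; _∷_; foldr; map; allFin; length; removeAt)
open import Data.List.Relation.Unary.All using (All)
open import Data.Vec using (tabulate; lookup)
open import Data.Product using (_×_; _,_; Σ; proj₁; proj₂)
open import Relation.Binary.PropositionalEquality using (_≡_; _≢_)
open import Relation.Nullary.Decidable using (⌊_⌋)
import Data.Fin as F

-- A (loopless multi)graph on vertex set Fin n: a list of edges (multiplicity
-- allowed), each edge a pair of distinct endpoints.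
record Graph (n : ℕ) : Set where
  constructor graph
  field
    edges    : List (Fin n × Fin n)
    loopless : All (λ e → proj₁ e ≢ proj₂ e) edges
open Graph public

deleteEdge : ∀ {n} (G : Graph n) → Fin (length (edges G)) → Graph n
deleteEdge (graph [] _) ()
deleteEdge (graph (e ∷ es) (p All.∷ ps)) Fin.zero = graph es ps
deleteEdge (graph (e ∷ es) (p All.∷ ps)) (Fin.suc i) with deleteEdge (graph es ps) i
... | graph es' ps' = graph (e ∷ es') (p All.∷ ps')

sumℤ : List ℤ → ℤ
sumℤ = foldr _+_ (+ 0)

SetFn : ℕ → Set
SetFn n = Subset n → ℤ

-- l(∅) = 0 (standing convention)
NormalizedAtEmpty : ∀ {n} → SetFn n → Set
NormalizedAtEmpty l = l ∅ ≡ + 0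

IntersectingSupermodular : ∀ {n} → SetFn n → Set
IntersectingSupermodular {n} l = ∀ (A B : Subset n) → Nonempty (A ∩ B) →
  l A + l B ≤ l (A ∩ B) + l (A ∪ B)

sumSingletons : ∀ {n} → SetFn n → Subset n → ℤ
sumSingletons {n} l A = sumℤ (map (λ v → if lookup A v then l ⁅ v ⁆ else + 0) (allFin n))

WeaklySubadditive : ∀ {n} → SetFn n → Set
WeaklySubadditive {n} l = ∀ (A : Subset n) → l A ≤ sumSingletons l A

record Partition (n : ℕ) : Set where
  constructor partition
  field
    k        : ℕ
    part     : Fin n → Fin k
    nonempty : ∀ (i : Fin k) → Σ (Fin n) (λ v → part v ≡ i)
open Partition public

partSet : ∀ {n} (P : Partition n) → Fin (k P) → Subset n
partSet P i = tabulate (λ v → ⌊ part P v F.≟ i ⌋)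

crossing : ∀ {n} → Partition n → List (Fin n × Fin n) → ℕ
crossing P [] = 0
crossing P ((u , v) ∷ es) =
  if ⌊ part P u F.≟ part P v ⌋ then crossing P es else suc (crossing P es)

eK : ∀ {n} → Graph n → Partition n → ℕ
eK G P = crossing P (edges G)

PartitionConnected : ∀ {n} → SetFn n → Graph n → Set
PartitionConnected {n} l G = ∀ (P : Partition n) →
  sumℤ (map (λ i → l (partSet P i)) (allFin (k P))) - l ⊤ ≤ + eK G P

MinimallyPartitionConnected : ∀ {n} → SetFn n → Graph n → Set
MinimallyPartitionConnected l G =
  PartitionConnected l G ×
  (∀ (i : Fin (length (edges G))) → PartitionConnected l (deleteEdge G i) → Data.Empty.⊥)
  where import Data.Empty

-- Work with labellings f : Fin n → Fin m, i.e. partitions of V(H) whose blocks may be empty,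
-- valued by Σⱼ l (f⁻¹ j), an empty block contributing l ∅ = 0. Partition-connectivity bounds
-- this value by l(V) plus the number of edges that f cuts; call f tight when equality holds.
-- The discrete labelling gives Σᵥ l(v) − l(V) ≤ |E|. For the converse start from the trivial
-- labelling, which is tight. If an edge e lies inside a block A of a tight f, minimality yields
-- a partition P violated by H − e; P is then tight and separates e. Splitting A along P and
-- merging the blocks of P that meet A into one block does not decrease the total value (an
-- iterated uncrossing by intersecting supermodularity) and does not increase the number of cut
-- edges, so the split of f is again tight, and it cuts strictly more edges. Once every edge is
-- cut, weak subadditivity bounds the value by Σᵥ l(v), giving |E| ≤ Σᵥ l(v) − l(V).

module Submission where

open import Defs
open import Data.Nat as ℕ using (ℕ; zero; suc; z≤n; s≤s)
import Data.Nat.Properties as ℕP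
open import Data.Integer using (ℤ; +_; _+_; _-_; -_; _≤_; _<_; +≤+)
import Data.Integer.Properties as ℤP
open import Data.Integer.Tactic.RingSolver using (solve-∀)
open import Data.Fin using (Fin; zero; suc; punchIn; punchOut; _↑ˡ_; _↑ʳ_; splitAt; _≟_)
open import Data.Fin.Properties
  using (suc-injective; punchIn-injective; punchIn-punchOut; punchInᵢ≢i; ↑ˡ-injective; ↑ʳ-injective;
         splitAt-↑ˡ; splitAt-↑ʳ; all?; any?; ¬∀⟶∃¬)
open import Data.Fin.Subset using (Subset; _∈_; _∩_; _∪_; ⋃; ⁅_⁆; ⊤; Nonempty; Empty) renaming (⊥ to ∅)
open import Data.Fin.Subset.Properties
  using (⊆-antisym; ∈⊤; ∉⊥; x∈⁅x⁆; x∈⁅y⁆⇒x≡y; x∈p∩q⁺; x∈p∩q⁻; x∈p∪q⁺; x∈p∪q⁻; p⊆p∪q; Empty-unique;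
         nonempty?; ∩-distribʳ-∪; ∩-zeroʳ; ∪-identityʳ; ∪-assoc; ∪-comm)
open import Data.List as List using (List; []; _∷_; length; map; allFin)
import Data.List.Properties as ListP
open import Data.List.Relation.Unary.All using (All; []; _∷_)
open import Data.List.Relation.Unary.All.Properties using (¬Any⇒All¬)
open import Data.List.Relation.Unary.Any as Any using ()
open import Data.List.Relation.Unary.Any.Properties using (lookup-index)
open import Data.Vec using (tabulate; lookup)
open import Data.Vec.Properties using (lookup∘tabulate; lookup⇒[]=; []=⇒lookup; tabulate-cong; lookup-replicate)
open import Data.Bool using (true; false; if_then_else_)
open import Data.Bool.Properties using (T-≡)
open import Data.Empty using (⊥; ⊥-elim)
open import Data.Product using (Σ; ∃; _×_; _,_; proj₁; proj₂)
import Data.Product as Product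
open import Data.Sum using (_⊎_; inj₁; inj₂)
open import Function using (_∘_; id; flip; _⇔_; mk⇔; Equivalence)
open import Relation.Binary.PropositionalEquality
open import Relation.Nullary using (¬_; Dec; yes; no; contradiction)
open import Relation.Nullary.Decidable using (⌊_⌋; isYes≗does; dec-true; dec-false; toWitness; decidable-stable)
open import Algebra.Properties.CommutativeMonoid.Sum ℤP.+-0-commutativeMonoid
  using (sum; sum-cong-≗; sum-remove; sum-replicate-zero; ∑-distrib-+; ∑-comm)
import Algebra.Properties.CommutativeSemigroup ℕP.+-commutativeSemigroup as ℕ+
import Algebra.Properties.CommutativeSemigroup ℤP.+-commutativeSemigroup as ℤ+

sumℤ-tabulate : ∀ {k} (h : Fin k → ℤ) → sumℤ (List.tabulate h) ≡ sum h
sumℤ-tabulate {zero}  h = refl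
sumℤ-tabulate {suc k} h = cong (_+_ (h zero)) (sumℤ-tabulate (h ∘ suc))

sumℤ-allFin : ∀ {k} (h : Fin k → ℤ) → sumℤ (map h (allFin k)) ≡ sum h
sumℤ-allFin h = trans (cong sumℤ (ListP.map-tabulate id h)) (sumℤ-tabulate h)

sum-mono-≤ : ∀ {k} {h g : Fin k → ℤ} → (∀ i → h i ≤ g i) → sum h ≤ sum g
sum-mono-≤ {zero}  _   = ℤP.≤-refl
sum-mono-≤ {suc k} h≤g = ℤP.+-mono-≤ (h≤g zero) (sum-mono-≤ (h≤g ∘ suc))

sum-↑ : ∀ m {k} (h : Fin (m ℕ.+ k) → ℤ) →
        sum h ≡ sum (h ∘ (_↑ˡ k)) + sum (h ∘ (m ↑ʳ_))
sum-↑ zero    h = sym (ℤP.+-identityˡ _)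
sum-↑ (suc m) h = trans (cong (_+_ (h zero)) (sum-↑ m (h ∘ suc))) (sym (ℤP.+-assoc (h zero) _ _))

sum-single : ∀ {k} (a : Fin k) (h : Fin k → ℤ) → (∀ j → ¬ j ≡ a → h j ≡ + 0) → sum h ≡ h a
sum-single {suc k} a h vanish = begin
  sum h                      ≡⟨ sum-remove {i = a} h ⟩
  h a + sum (h ∘ punchIn a)  ≡⟨ cong (_+_ (h a)) (sum-cong-≗ {k} (λ j → vanish _ (punchInᵢ≢i a j))) ⟩
  h a + sum {k} (λ _ → + 0) ≡⟨ cong (_+_ (h a)) (sum-replicate-zero k) ⟩
  h a + + 0                  ≡⟨ ℤP.+-identityʳ (h a) ⟩
  h a                        ∎
  where open ≡-Reasoning


module _ {n : ℕ} where

  ⋃ᶠ : ∀ {k} → (Fin k → Subset n) → Subset n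
  ⋃ᶠ C = ⋃ (List.tabulate C)

  ∈-⋃ᶠ⁺ : ∀ {k} (C : Fin k → Subset n) i {x} → x ∈ C i → x ∈ ⋃ᶠ C
  ∈-⋃ᶠ⁺ C zero    x∈C₀ = x∈p∪q⁺ (inj₁ x∈C₀)
  ∈-⋃ᶠ⁺ C (suc i) x∈Cᵢ = x∈p∪q⁺ (inj₂ (∈-⋃ᶠ⁺ (C ∘ suc) i x∈Cᵢ))

  ∈-⋃ᶠ⁻ : ∀ {k} (C : Fin k → Subset n) {x} → x ∈ ⋃ᶠ C → ∃ λ i → x ∈ C i
  ∈-⋃ᶠ⁻ {zero}  C x∈∅ = ⊥-elim (∉⊥ x∈∅)
  ∈-⋃ᶠ⁻ {suc k} C x∈⋃ with x∈p∪q⁻ (C zero) _ x∈⋃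
  ... | inj₁ x∈C₀ = zero , x∈C₀
  ... | inj₂ x∈⋃′ = Product.map suc id (∈-⋃ᶠ⁻ (C ∘ suc) x∈⋃′)

  ⋃ᶠ-disjoint : ∀ {k} (C : Fin k → Subset n) D → (∀ i → Empty (C i ∩ D)) → ⋃ᶠ C ∩ D ≡ ∅
  ⋃ᶠ-disjoint C D disjoint = Empty-unique λ (x , x∈⋃∩D) → separate (x∈p∩q⁻ (⋃ᶠ C) D x∈⋃∩D)
    where
    separate : ∀ {x} → x ∈ ⋃ᶠ C × x ∈ D → ⊥
    separate (x∈⋃ , x∈D) with ∈-⋃ᶠ⁻ C x∈⋃
    ... | i , x∈Cᵢ = disjoint i (_ , x∈p∩q⁺ (x∈Cᵢ , x∈D))

  MeetsOrEmpty : Subset n → Subset n → Set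
  MeetsOrEmpty A C = Nonempty (A ∩ C) ⊎ C ≡ ∅

  module _ (l : SetFn n) (supermodular : IntersectingSupermodular l) where

    supermodular-or-empty : ∀ W C → MeetsOrEmpty W C → l W + l C ≤ l (W ∩ C) + l (W ∪ C)
    supermodular-or-empty W C (inj₁ W∩C≢∅) = supermodular W C W∩C≢∅
    supermodular-or-empty W C (inj₂ refl) = ℤP.≤-reflexive (begin
      l W + l ∅              ≡⟨ ℤP.+-comm (l W) (l ∅) ⟩
      l ∅ + l W              ≡⟨ cong₂ (λ p q → l p + l q) (sym (∩-zeroʳ W)) (sym (∪-identityʳ W)) ⟩
      l (W ∩ ∅) + l (W ∪ ∅)  ∎)
      where open ≡-Reasoning

    -- Uncross C₀ against A ∪ C₁ ∪ C₂ ∪ …; disjointness makes their intersection A ∩ C₀.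
    uncross : ∀ {k} (A : Subset n) (C : Fin k → Subset n) →
              (∀ i j → ¬ i ≡ j → Empty (C i ∩ C j)) → (∀ i → MeetsOrEmpty A (C i)) →
              l A + sum (l ∘ C) ≤ sum (λ i → l (A ∩ C i)) + l (A ∪ ⋃ᶠ C)
    uncross {zero} A C _ _ = ℤP.≤-reflexive (begin
      l A + + 0      ≡⟨ ℤP.+-identityʳ (l A) ⟩
      l A            ≡⟨ cong l (sym (∪-identityʳ A)) ⟩
      l (A ∪ ∅)      ≡⟨ ℤP.+-identityˡ (l (A ∪ ∅)) ⟨
      + 0 + l (A ∪ ∅) ∎)
      where open ≡-Reasoning
    uncross {suc k} A C disjoint meets = begin
      l A + (l C₀ + S′)                    ≡⟨ ℤ+.x∙yz≈xz∙y (l A) (l C₀) S′ ⟩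
      (l A + S′) + l C₀                    ≤⟨ ℤP.+-monoˡ-≤ (l C₀) ih ⟩
      (T′ + l W′) + l C₀                   ≡⟨ ℤP.+-assoc T′ (l W′) (l C₀) ⟩
      T′ + (l W′ + l C₀)                   ≤⟨ ℤP.+-monoʳ-≤ T′ (supermodular-or-empty W′ C₀ W′-meets) ⟩
      T′ + (l (W′ ∩ C₀) + l (W′ ∪ C₀))     ≡⟨ cong₂ (λ p q → T′ + (l p + l q)) W′∩C₀ W′∪C₀ ⟩
      T′ + (l (A ∩ C₀) + l (A ∪ ⋃ᶠ C))     ≡⟨ ℤ+.x∙yz≈yx∙z T′ (l (A ∩ C₀)) (l (A ∪ ⋃ᶠ C)) ⟩
      (l (A ∩ C₀) + T′) + l (A ∪ ⋃ᶠ C)     ∎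
      where
      open ℤP.≤-Reasoning
      C₀ U′ W′ : Subset n
      C₀ = C zero
      U′ = ⋃ᶠ (C ∘ suc)
      W′ = A ∪ U′
      S′ T′ : ℤ
      S′ = sum (l ∘ C ∘ suc)
      T′ = sum (λ i → l (A ∩ C (suc i)))
      ih : l A + S′ ≤ T′ + l W′
      ih = uncross A (C ∘ suc) (λ i j i≢j → disjoint (suc i) (suc j) (i≢j ∘ suc-injective))
                               (meets ∘ suc)
      U′∩C₀ : U′ ∩ C₀ ≡ ∅
      U′∩C₀ = ⋃ᶠ-disjoint (C ∘ suc) C₀ (λ i → disjoint (suc i) zero λ ())
      W′∩C₀ : W′ ∩ C₀ ≡ A ∩ C₀
      W′∩C₀ = trans (∩-distribʳ-∪ C₀ A U′)
                    (trans (cong ((A ∩ C₀) ∪_) U′∩C₀) (∪-identityʳ (A ∩ C₀)))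
      W′∪C₀ : W′ ∪ C₀ ≡ A ∪ ⋃ᶠ C
      W′∪C₀ = trans (∪-assoc A U′ C₀) (cong (A ∪_) (∪-comm U′ C₀))
      W′-meets : MeetsOrEmpty W′ C₀
      W′-meets with meets zero
      ... | inj₂ C₀≡∅ = inj₂ C₀≡∅
      ... | inj₁ (x , x∈A∩C₀) with x∈p∩q⁻ A C₀ x∈A∩C₀
      ...   | x∈A , x∈C₀ = inj₁ (x , x∈p∩q⁺ (p⊆p∪q U′ x∈A , x∈C₀))

module _ {n : ℕ} where

  block : ∀ {m} → (Fin n → Fin m) → Fin m → Subset n
  block f j = tabulate (λ v → ⌊ f v ≟ j ⌋)

  lookup-block-≡ : ∀ {m} {f : Fin n → Fin m} {x j} → f x ≡ j → lookup (block f j) x ≡ true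
  lookup-block-≡ {f = f} {x} {j} fx≡j =
    trans (lookup∘tabulate _ x) (trans (isYes≗does (f x ≟ j)) (dec-true (f x ≟ j) fx≡j))

  lookup-block-≢ : ∀ {m} {f : Fin n → Fin m} {x j} → ¬ f x ≡ j → lookup (block f j) x ≡ false
  lookup-block-≢ {f = f} {x} {j} fx≢j =
    trans (lookup∘tabulate _ x) (trans (isYes≗does (f x ≟ j)) (dec-false (f x ≟ j) fx≢j))

  ∈-block⁺ : ∀ {m} {f : Fin n → Fin m} {x j} → f x ≡ j → x ∈ block f j
  ∈-block⁺ {x = x} fx≡j = lookup⇒[]= x _ (lookup-block-≡ fx≡j)

  ∈-block⁻ : ∀ {m} {f : Fin n → Fin m} {x j} → x ∈ block f j → f x ≡ j
  ∈-block⁻ {x = x} x∈ = toWitness (Equivalence.from T-≡ (trans (sym (lookup∘tabulate _ x)) ([]=⇒lookup x∈)))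

  block-cong : ∀ {m} {f g : Fin n → Fin m} → (∀ v → f v ≡ g v) → ∀ j → block f j ≡ block g j
  block-cong f≗g j = tabulate-cong (λ v → cong (λ i → ⌊ i ≟ j ⌋) (f≗g v))

  block-disjoint : ∀ {m} (f : Fin n → Fin m) {i j} → ¬ i ≡ j → Empty (block f i ∩ block f j)
  block-disjoint f i≢j (x , x∈) with x∈p∩q⁻ (block f _) _ x∈
  ... | x∈i , x∈j = i≢j (trans (sym (∈-block⁻ x∈i)) (∈-block⁻ x∈j))

  value : ∀ {m} → SetFn n → (Fin n → Fin m) → ℤ
  value l f = sum (λ j → l (block f j))

  separates : ∀ {m} → (Fin n → Fin m) → Fin n × Fin n → ℕ
  separates f (u , v) = if ⌊ f u ≟ f v ⌋ then 0 else 1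

  cut : ∀ {m} → (Fin n → Fin m) → List (Fin n × Fin n) → ℕ
  cut f []       = 0
  cut f (e ∷ es) = separates f e ℕ.+ cut f es

  separates-≡ : ∀ {m} (f : Fin n → Fin m) {u v} → f u ≡ f v → separates f (u , v) ≡ 0
  separates-≡ f {u} {v} fu≡fv with f u ≟ f v
  ... | yes _     = refl
  ... | no fu≢fv = contradiction fu≡fv fu≢fv

  separates-≢ : ∀ {m} (f : Fin n → Fin m) {u v} → ¬ f u ≡ f v → separates f (u , v) ≡ 1
  separates-≢ f {u} {v} fu≢fv with f u ≟ f v
  ... | yes fu≡fv = contradiction fu≡fv fu≢fv
  ... | no _      = refl

  separates≤1 : ∀ {m} (f : Fin n → Fin m) e → separates f e ℕ.≤ 1
  separates≤1 f (u , v) with f u ≟ f v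
  ... | yes _ = z≤n
  ... | no _  = s≤s z≤n

  SameBlocks : ∀ {m m′} → (Fin n → Fin m) → (Fin n → Fin m′) → Set
  SameBlocks f g = ∀ u v → f u ≡ f v ⇔ g u ≡ g v

  separates-cong : ∀ {m m′} {f : Fin n → Fin m} {g : Fin n → Fin m′} →
                   SameBlocks f g → ∀ e → separates f e ≡ separates g e
  separates-cong {f = f} {g} f∼g (u , v) with f u ≟ f v
  ... | yes fu≡fv = sym (separates-≡ g (Equivalence.to (f∼g u v) fu≡fv))
  ... | no fu≢fv  = sym (separates-≢ g (fu≢fv ∘ Equivalence.from (f∼g u v)))

  separates-coarser : ∀ {m m′} (f : Fin n → Fin m) (g : Fin n → Fin m′) {u v} →
                      (g u ≡ g v → f u ≡ f v) → separates f (u , v) ℕ.≤ separates g (u , v)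
  separates-coarser f g {u} {v} g⇒f with g u ≟ g v
  ... | yes gu≡gv = ℕP.≤-reflexive (separates-≡ f (g⇒f gu≡gv))
  ... | no _      = separates≤1 f (u , v)

  cut-cong : ∀ {m m′} {f : Fin n → Fin m} {g : Fin n → Fin m′} →
             SameBlocks f g → ∀ es → cut f es ≡ cut g es
  cut-cong f∼g []       = refl
  cut-cong f∼g (e ∷ es) = cong₂ ℕ._+_ (separates-cong f∼g e) (cut-cong f∼g es)

  cut-mono : ∀ {m m′} {f : Fin n → Fin m} {g : Fin n → Fin m′} →
             (∀ e → separates f e ℕ.≤ separates g e) → ∀ es → cut f es ℕ.≤ cut g es
  cut-mono f≤g []       = z≤n
  cut-mono f≤g (e ∷ es) = ℕP.+-mono-≤ (f≤g e) (cut-mono f≤g es)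

  cut-+-mono : ∀ {m₁ m₂ m₃ m₄} {f₁ : Fin n → Fin m₁} {f₂ : Fin n → Fin m₂}
                               {g₁ : Fin n → Fin m₃} {g₂ : Fin n → Fin m₄} →
               (∀ e → separates f₁ e ℕ.+ separates f₂ e ℕ.≤ separates g₁ e ℕ.+ separates g₂ e) →
               ∀ es → cut f₁ es ℕ.+ cut f₂ es ℕ.≤ cut g₁ es ℕ.+ cut g₂ es
  cut-+-mono f≤g []       = z≤n
  cut-+-mono {f₁ = f₁} {f₂} {g₁} {g₂} f≤g (e ∷ es) = begin
    (separates f₁ e ℕ.+ cut f₁ es) ℕ.+ (separates f₂ e ℕ.+ cut f₂ es)
      ≡⟨ ℕ+.interchange (separates f₁ e) (cut f₁ es) _ _ ⟩
    (separates f₁ e ℕ.+ separates f₂ e) ℕ.+ (cut f₁ es ℕ.+ cut f₂ es)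
      ≤⟨ ℕP.+-mono-≤ (f≤g e) (cut-+-mono f≤g es) ⟩
    (separates g₁ e ℕ.+ separates g₂ e) ℕ.+ (cut g₁ es ℕ.+ cut g₂ es)
      ≡⟨ ℕ+.interchange (separates g₁ e) (separates g₂ e) _ _ ⟩
    (separates g₁ e ℕ.+ cut g₁ es) ℕ.+ (separates g₂ e ℕ.+ cut g₂ es) ∎
    where open ℕP.≤-Reasoning

  cut≤length : ∀ {m} (f : Fin n → Fin m) es → cut f es ℕ.≤ length es
  cut≤length f []       = z≤n
  cut≤length f (e ∷ es) = ℕP.+-mono-≤ (separates≤1 f e) (cut≤length f es)

  cut-all-separated : ∀ {m} (f : Fin n → Fin m) {es} →
                      All (λ e → ¬ f (proj₁ e) ≡ f (proj₂ e)) es → cut f es ≡ length es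
  cut-all-separated f []           = refl
  cut-all-separated f (fu≢fv ∷ ps) = cong₂ ℕ._+_ (separates-≢ f fu≢fv) (cut-all-separated f ps)

  cut-removeAt : ∀ {m} (f : Fin n → Fin m) es (i : Fin (length es)) →
                 cut f es ≡ separates f (List.lookup es i) ℕ.+ cut f (List.removeAt es i)
  cut-removeAt f (e ∷ es) zero    = refl
  cut-removeAt f (e ∷ es) (suc i) = begin
    separates f e ℕ.+ cut f es
      ≡⟨ cong (separates f e ℕ.+_) (cut-removeAt f es i) ⟩
    separates f e ℕ.+ (separates f (List.lookup es i) ℕ.+ cut f (List.removeAt es i))
      ≡⟨ ℕ+.x∙yz≈y∙xz (separates f e) (separates f (List.lookup es i)) (cut f (List.removeAt es i)) ⟩
    separates f (List.lookup es i) ℕ.+ (separates f e ℕ.+ cut f (List.removeAt es i)) ∎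
    where open ≡-Reasoning

  crossing≡cut : ∀ (P : Partition n) es → crossing P es ≡ cut (part P) es
  crossing≡cut P []             = refl
  crossing≡cut P ((u , v) ∷ es) with part P u ≟ part P v
  ... | yes _ = crossing≡cut P es
  ... | no _  = cong suc (crossing≡cut P es)

  edges-deleteEdge : ∀ (G : Graph n) i → edges (deleteEdge G i) ≡ List.removeAt (edges G) i
  edges-deleteEdge (graph (e ∷ es) (p ∷ ps)) zero    = refl
  edges-deleteEdge (graph (e ∷ es) (p ∷ ps)) (suc i)
    with deleteEdge (graph es ps) i | edges-deleteEdge (graph es ps) i
  ... | graph es′ ps′ | refl = refl

  value-punchIn : ∀ (l : SetFn n) → NormalizedAtEmpty l →
                  ∀ {m} (j : Fin (suc m)) (g : Fin n → Fin m) → value l (punchIn j ∘ g) ≡ value l g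
  value-punchIn l l∅≡0 {m} j g = begin
    value l g′                                              ≡⟨ sum-remove {i = j} (l ∘ block g′) ⟩
    l (block g′ j) + sum (λ i → l (block g′ (punchIn j i)))  ≡⟨ cong₂ _+_ (trans (cong l missed) l∅≡0)
                                                                          (sum-cong-≗ (cong l ∘ shifted)) ⟩
    + 0 + value l g                                         ≡⟨ ℤP.+-identityˡ (value l g) ⟩
    value l g                                               ∎
    where
    open ≡-Reasoning
    g′ : Fin n → Fin (suc m)
    g′ = punchIn j ∘ g
    missed : block g′ j ≡ ∅
    missed = Empty-unique λ (x , x∈) → punchInᵢ≢i j (g x) (∈-block⁻ x∈)
    shifted : ∀ i → block g′ (punchIn j i) ≡ block g i
    shifted i = ⊆-antisym (λ x∈ → ∈-block⁺ (punchIn-injective j _ _ (∈-block⁻ x∈)))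
                          (λ x∈ → ∈-block⁺ (cong (punchIn j) (∈-block⁻ x∈)))

  Compression : ∀ {m} → (Fin n → Fin m) → Set
  Compression f = Σ (Partition n) λ P →
    SameBlocks (part P) f × (∀ (l : SetFn n) → NormalizedAtEmpty l → value l (part P) ≡ value l f)

  compression-punchIn : ∀ {m} (f : Fin n → Fin (suc m)) (j : Fin (suc m)) (g : Fin n → Fin m) →
                        (∀ v → f v ≡ punchIn j (g v)) → Compression g → Compression f
  compression-punchIn f j g f≗jg (P , P∼g , P≈g) = P , P∼f , P≈f
    where
    P∼f : SameBlocks (part P) f
    P∼f u v = mk⇔
      (λ Pu≡Pv → trans (f≗jg u) (trans (cong (punchIn j) (Equivalence.to (P∼g u v) Pu≡Pv)) (sym (f≗jg v))))
      (λ fu≡fv → Equivalence.from (P∼g u v)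
                   (punchIn-injective j _ _ (trans (sym (f≗jg u)) (trans fu≡fv (f≗jg v)))))
    P≈f : ∀ (l : SetFn n) → NormalizedAtEmpty l → value l (part P) ≡ value l f
    P≈f l l∅≡0 = begin
      value l (part P)         ≡⟨ P≈g l l∅≡0 ⟩
      value l g                ≡⟨ value-punchIn l l∅≡0 j g ⟨
      value l (punchIn j ∘ g)  ≡⟨ sum-cong-≗ (cong l ∘ block-cong f≗jg) ⟨
      value l f                ∎
      where open ≡-Reasoning

  compress : ∀ {m} (f : Fin n → Fin m) → Compression f
  compress-without : ∀ {m} (f : Fin n → Fin m) j → ¬ ∃ (λ v → f v ≡ j) → Compression f

  compress {m} f with all? (λ j → any? (λ v → f v ≟ j))
  ... | yes onto = partition m f onto , (λ u v → mk⇔ id id) , (λ _ _ → refl)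
  ... | no ¬onto = let j , unused = ¬∀⟶∃¬ m _ (λ j → any? (λ v → f v ≟ j)) ¬onto
                   in compress-without f j unused

  compress-without {suc m} f j unused =
    compression-punchIn f j g (λ v → sym (punchIn-punchOut _)) (compress g)
    where
    g : Fin n → Fin m
    g v = punchOut {i = j} {j = f v} (λ j≡fv → unused (v , sym j≡fv))

  partitionConnected⇒value-⊤≤cut :
    ∀ (l : SetFn n) (G : Graph n) → NormalizedAtEmpty l → PartitionConnected l G →
    ∀ {m} (f : Fin n → Fin m) → value l f - l ⊤ ≤ + cut f (edges G)
  partitionConnected⇒value-⊤≤cut l G l∅≡0 connected f with compress f
  ... | P , P∼f , P≈f =
    subst₂ (λ x c → x - l ⊤ ≤ + c)
           (trans (sumℤ-allFin (λ i → l (partSet P i))) (P≈f l l∅≡0))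
           (trans (crossing≡cut P (edges G)) (cut-cong P∼f (edges G)))
           (connected P)

  trivial : Fin n → Fin 1
  trivial _ = zero

  value-trivial : ∀ (l : SetFn n) → value l trivial ≡ l ⊤
  value-trivial l = trans (ℤP.+-identityʳ (l (block trivial zero)))
                          (cong l (⊆-antisym (λ _ → ∈⊤) (λ _ → ∈-block⁺ {f = trivial} refl)))

  cut-const : ∀ {m} (j : Fin m) es → cut (λ _ → j) es ≡ 0
  cut-const j []       = refl
  cut-const j (e ∷ es) = cong₂ ℕ._+_ (separates-≡ (λ _ → j) {proj₁ e} {proj₂ e} refl) (cut-const j es)

  sumSingletons-⊤ : ∀ (l : SetFn n) → sumSingletons l ⊤ ≡ sum (λ v → l ⁅ v ⁆)
  sumSingletons-⊤ l = trans (sumℤ-allFin (λ v → if lookup ⊤ v then l ⁅ v ⁆ else + 0))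
    (sum-cong-≗ λ v → cong (λ b → if b then l ⁅ v ⁆ else + 0) (lookup-replicate v true))

  value-id : ∀ (l : SetFn n) → value l id ≡ sumSingletons l ⊤
  value-id l = trans (sum-cong-≗ λ j → cong l (block-id j)) (sym (sumSingletons-⊤ l))
    where
    block-id : ∀ j → block id j ≡ ⁅ j ⁆
    block-id j = ⊆-antisym (λ x∈ → subst (_∈ ⁅ j ⁆) (sym (∈-block⁻ x∈)) (x∈⁅x⁆ j))
                           (λ x∈ → ∈-block⁺ (x∈⁅y⁆⇒x≡y j x∈))

  value≤sumSingletons : ∀ (l : SetFn n) → WeaklySubadditive l →
                        ∀ {m} (f : Fin n → Fin m) → value l f ≤ sumSingletons l ⊤
  value≤sumSingletons l subadditive {m} f = begin
    value l f                                ≤⟨ sum-mono-≤ (λ j → subadditive (block f j)) ⟩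
    sum (λ j → sumSingletons l (block f j))  ≡⟨ sum-cong-≗ (λ j → sumℤ-allFin (δ j)) ⟩
    sum (λ j → sum (λ v → δ j v))            ≡⟨ ∑-comm δ ⟩
    sum (λ v → sum (λ j → δ j v))            ≡⟨ sum-cong-≗ (λ v → sum-single (f v) (λ j → δ j v) (δ-off v)) ⟩
    sum (λ v → δ (f v) v)                    ≡⟨ sum-cong-≗ δ-on ⟩
    sum (λ v → l ⁅ v ⁆)                      ≡⟨ sumSingletons-⊤ l ⟨
    sumSingletons l ⊤                        ∎
    where
    open ℤP.≤-Reasoning
    δ : Fin m → Fin n → ℤ
    δ j v = if lookup (block f j) v then l ⁅ v ⁆ else + 0
    δ-on : ∀ v → δ (f v) v ≡ l ⁅ v ⁆
    δ-on v = cong (λ b → if b then l ⁅ v ⁆ else + 0) (lookup-block-≡ refl)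
    δ-off : ∀ v j → ¬ j ≡ f v → δ j v ≡ + 0
    δ-off v j j≢fv = cong (λ b → if b then l ⁅ v ⁆ else + 0) (lookup-block-≢ (j≢fv ∘ sym))

↑ˡ≢↑ʳ : ∀ {m k} (i : Fin m) (j : Fin k) → ¬ i ↑ˡ k ≡ m ↑ʳ j
↑ˡ≢↑ʳ {m} {k} i j eq with trans (sym (splitAt-↑ˡ m i k)) (trans (cong (splitAt m) eq) (splitAt-↑ʳ m k j))
... | ()

module SplitMerge {n m k : ℕ} (f : Fin n → Fin (suc m)) (a : Fin (suc m)) (P : Fin n → Fin k) where

  A : Subset n
  A = block f a

  split : Fin n → Fin (m ℕ.+ k)
  split v with f v ≟ a
  ... | yes _   = m ↑ʳ P v
  ... | no fv≢a = punchOut (fv≢a ∘ sym) ↑ˡ k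

  split-cases : ∀ v → (f v ≡ a × split v ≡ m ↑ʳ P v) ⊎ ∃ λ j → f v ≡ punchIn a j × split v ≡ j ↑ˡ k
  split-cases v with f v ≟ a
  ... | yes fv≡a = inj₁ (fv≡a , refl)
  ... | no fv≢a  = inj₂ (_ , sym (punchIn-punchOut (fv≢a ∘ sym)) , refl)

  split-≡⇒f-≡ : ∀ {u v} → split u ≡ split v → f u ≡ f v
  split-≡⇒f-≡ {u} {v} su≡sv with split-cases u | split-cases v
  ... | inj₁ (fu≡a , _)       | inj₁ (fv≡a , _)       = trans fu≡a (sym fv≡a)
  ... | inj₁ (_ , su)         | inj₂ (_ , _ , sv)     = ⊥-elim (↑ˡ≢↑ʳ _ _ (trans (sym sv) (trans (sym su≡sv) su)))
  ... | inj₂ (_ , _ , su)     | inj₁ (_ , sv)         = ⊥-elim (↑ˡ≢↑ʳ _ _ (trans (sym su) (trans su≡sv sv)))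
  ... | inj₂ (i , fu≡ai , su) | inj₂ (j , fv≡aj , sv) =
    trans fu≡ai (trans (cong (punchIn a) (↑ˡ-injective k i j (trans (sym su) (trans su≡sv sv)))) (sym fv≡aj))

  split-≡ : ∀ {u v} → f u ≡ f v → (f u ≡ a → P u ≡ P v) → split u ≡ split v
  split-≡ {u} {v} fu≡fv inside⇒P with split-cases u | split-cases v
  ... | inj₁ (fu≡a , su)      | inj₁ (_ , sv)         = trans su (trans (cong (m ↑ʳ_) (inside⇒P fu≡a)) (sym sv))
  ... | inj₁ (fu≡a , _)       | inj₂ (j , fv≡aj , _)  =
    ⊥-elim (punchInᵢ≢i a j (trans (sym fv≡aj) (trans (sym fu≡fv) fu≡a)))
  ... | inj₂ (i , fu≡ai , _)  | inj₁ (fv≡a , _)       =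
    ⊥-elim (punchInᵢ≢i a i (trans (sym fu≡ai) (trans fu≡fv fv≡a)))
  ... | inj₂ (i , fu≡ai , su) | inj₂ (j , fv≡aj , sv) =
    trans su (trans (cong (_↑ˡ k) (punchIn-injective a i j (trans (sym fu≡ai) (trans fu≡fv fv≡aj)))) (sym sv))

  split-separates : ∀ {u v} → f u ≡ a → f v ≡ a → ¬ P u ≡ P v → ¬ split u ≡ split v
  split-separates {u} {v} fu≡a fv≡a Pu≢Pv su≡sv with split-cases u | split-cases v
  ... | inj₁ (_ , su) | inj₁ (_ , sv) = Pu≢Pv (↑ʳ-injective m _ _ (trans (sym su) (trans su≡sv sv)))
  ... | inj₂ (i , fu≡ai , _) | _ = punchInᵢ≢i a i (trans (sym fu≡ai) fu≡a)
  ... | _ | inj₂ (j , fv≡aj , _) = punchInᵢ≢i a j (trans (sym fv≡aj) fv≡a)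

  block-split-↑ˡ : ∀ j → block split (j ↑ˡ k) ≡ block f (punchIn a j)
  block-split-↑ˡ j = ⊆-antisym (λ x∈ → to (∈-block⁻ x∈)) (λ x∈ → ∈-block⁺ (from (∈-block⁻ x∈)))
    where
    to : ∀ {x} → split x ≡ j ↑ˡ k → x ∈ block f (punchIn a j)
    to {x} sx≡j with split-cases x
    ... | inj₁ (_ , sx)           = ⊥-elim (↑ˡ≢↑ʳ j (P x) (trans (sym sx≡j) sx))
    ... | inj₂ (i , fx≡ai , sx)   =
      ∈-block⁺ (trans fx≡ai (cong (punchIn a) (↑ˡ-injective k i j (trans (sym sx) sx≡j))))
    from : ∀ {x} → f x ≡ punchIn a j → split x ≡ j ↑ˡ k
    from {x} fx≡aj with split-cases x
    ... | inj₁ (fx≡a , _)         = ⊥-elim (punchInᵢ≢i a j (trans (sym fx≡aj) fx≡a))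
    ... | inj₂ (i , fx≡ai , sx)   = trans sx (cong (_↑ˡ k) (punchIn-injective a i j (trans (sym fx≡ai) fx≡aj)))

  block-split-↑ʳ : ∀ i → block split (m ↑ʳ i) ≡ A ∩ block P i
  block-split-↑ʳ i = ⊆-antisym (λ x∈ → to (∈-block⁻ x∈)) from
    where
    to : ∀ {x} → split x ≡ m ↑ʳ i → x ∈ A ∩ block P i
    to {x} sx≡i with split-cases x
    ... | inj₁ (fx≡a , sx)   = x∈p∩q⁺ (∈-block⁺ fx≡a , ∈-block⁺ (↑ʳ-injective m _ _ (trans (sym sx) sx≡i)))
    ... | inj₂ (j , _ , sx)  = ⊥-elim (↑ˡ≢↑ʳ j i (trans (sym sx) sx≡i))
    from : ∀ {x} → x ∈ A ∩ block P i → x ∈ block split (m ↑ʳ i)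
    from {x} x∈ with x∈p∩q⁻ A (block P i) x∈ | split-cases x
    ... | _ , x∈Bᵢ | inj₁ (_ , sx)          = ∈-block⁺ (trans sx (cong (m ↑ʳ_) (∈-block⁻ x∈Bᵢ)))
    ... | x∈A , _  | inj₂ (j , fx≡aj , _)   = ⊥-elim (punchInᵢ≢i a j (trans (sym fx≡aj) (∈-block⁻ x∈A)))

  Meets : Fin k → Set
  Meets i = Nonempty (A ∩ block P i)

  meets? : ∀ i → Dec (Meets i)
  meets? i = nonempty? (A ∩ block P i)

  mergeLabel : Fin k → Fin (suc k)
  mergeLabel i with meets? i
  ... | yes _ = zero
  ... | no _  = suc i

  merge : Fin n → Fin (suc k)
  merge = mergeLabel ∘ P

  kept : Fin k → Subset n
  kept i with meets? i
  ... | yes _ = block P i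
  ... | no _  = ∅

  dropped : Fin k → Subset n
  dropped i with meets? i
  ... | yes _ = ∅
  ... | no _  = block P i

  meets-inside : ∀ {x} → f x ≡ a → Meets (P x)
  meets-inside {x} fx≡a = x , x∈p∩q⁺ (∈-block⁺ fx≡a , ∈-block⁺ refl)

  mergeLabel-zero⁺ : ∀ {i} → Meets i → mergeLabel i ≡ zero
  mergeLabel-zero⁺ {i} meets with meets? i
  ... | yes _     = refl
  ... | no ¬meets = contradiction meets ¬meets

  mergeLabel-zero⁻ : ∀ {i} → mergeLabel i ≡ zero → Meets i
  mergeLabel-zero⁻ {i} eq with meets? i
  ... | yes meets = meets

  mergeLabel-suc⁺ : ∀ {i} → ¬ Meets i → mergeLabel i ≡ suc i
  mergeLabel-suc⁺ {i} ¬meets with meets? i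
  ... | yes meets = contradiction meets ¬meets
  ... | no _      = refl

  mergeLabel-suc⁻ : ∀ {i j} → mergeLabel i ≡ suc j → i ≡ j × ¬ Meets i
  mergeLabel-suc⁻ {i} eq with meets? i
  ... | no ¬meets = suc-injective eq , ¬meets

  ∈-kept⁺ : ∀ {i x} → x ∈ block P i → Meets i → x ∈ kept i
  ∈-kept⁺ {i} x∈ meets with meets? i
  ... | yes _     = x∈
  ... | no ¬meets = contradiction meets ¬meets

  ∈-kept⁻ : ∀ {i x} → x ∈ kept i → x ∈ block P i × Meets i
  ∈-kept⁻ {i} x∈ with meets? i
  ... | yes meets = x∈ , meets
  ... | no _      = ⊥-elim (∉⊥ x∈)

  ∈-dropped⁺ : ∀ {i x} → x ∈ block P i → ¬ Meets i → x ∈ dropped i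
  ∈-dropped⁺ {i} x∈ ¬meets with meets? i
  ... | yes meets = contradiction meets ¬meets
  ... | no _      = x∈

  ∈-dropped⁻ : ∀ {i x} → x ∈ dropped i → x ∈ block P i × ¬ Meets i
  ∈-dropped⁻ {i} x∈ with meets? i
  ... | yes _     = ⊥-elim (∉⊥ x∈)
  ... | no ¬meets = x∈ , ¬meets

  kept-disjoint : ∀ i j → ¬ i ≡ j → Empty (kept i ∩ kept j)
  kept-disjoint i j i≢j (x , x∈) with x∈p∩q⁻ (kept i) (kept j) x∈
  ... | x∈i , x∈j = block-disjoint P i≢j (x , x∈p∩q⁺ (proj₁ (∈-kept⁻ x∈i) , proj₁ (∈-kept⁻ x∈j)))

  kept-meets : ∀ i → MeetsOrEmpty A (kept i)
  kept-meets i with meets? i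
  ... | yes meets = inj₁ meets
  ... | no _      = inj₂ refl

  A∩kept : ∀ i → A ∩ kept i ≡ A ∩ block P i
  A∩kept i with meets? i
  ... | yes _     = refl
  ... | no ¬meets = trans (∩-zeroʳ A) (sym (Empty-unique ¬meets))

  l-kept+dropped : ∀ (l : SetFn n) → NormalizedAtEmpty l → ∀ i → l (kept i) + l (dropped i) ≡ l (block P i)
  l-kept+dropped l l∅≡0 i with meets? i
  ... | yes _ = trans (cong (_+_ (l (block P i))) l∅≡0) (ℤP.+-identityʳ _)
  ... | no _  = trans (cong (_+ l (block P i)) l∅≡0) (ℤP.+-identityˡ _)

  block-merge-zero : block merge zero ≡ A ∪ ⋃ᶠ kept
  block-merge-zero = ⊆-antisym (λ x∈ → to (∈-block⁻ x∈)) (λ x∈ → ∈-block⁺ (from (x∈p∪q⁻ A (⋃ᶠ kept) x∈)))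
    where
    to : ∀ {x} → merge x ≡ zero → x ∈ A ∪ ⋃ᶠ kept
    to {x} mx≡0 = x∈p∪q⁺ (inj₂ (∈-⋃ᶠ⁺ kept (P x) (∈-kept⁺ (∈-block⁺ refl) (mergeLabel-zero⁻ mx≡0))))
    from : ∀ {x} → x ∈ A ⊎ x ∈ ⋃ᶠ kept → merge x ≡ zero
    from (inj₁ x∈A) = mergeLabel-zero⁺ (meets-inside (∈-block⁻ x∈A))
    from (inj₂ x∈⋃) with ∈-⋃ᶠ⁻ kept x∈⋃
    ... | i , x∈kept with ∈-kept⁻ x∈kept
    ...   | x∈Bᵢ , meets = mergeLabel-zero⁺ (subst Meets (sym (∈-block⁻ x∈Bᵢ)) meets)

  block-merge-suc : ∀ i → block merge (suc i) ≡ dropped i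
  block-merge-suc i = ⊆-antisym (λ x∈ → to (∈-block⁻ x∈)) (λ x∈ → ∈-block⁺ (from (∈-dropped⁻ x∈)))
    where
    to : ∀ {x} → merge x ≡ suc i → x ∈ dropped i
    to {x} mx≡i with mergeLabel-suc⁻ mx≡i
    ... | Px≡i , ¬meets = ∈-dropped⁺ (∈-block⁺ Px≡i) (subst (¬_ ∘ Meets) Px≡i ¬meets)
    from : ∀ {x} → x ∈ block P i × ¬ Meets i → merge x ≡ suc i
    from (x∈Bᵢ , ¬meets) with ∈-block⁻ x∈Bᵢ
    ... | refl = mergeLabel-suc⁺ ¬meets

  value-split-merge : ∀ (l : SetFn n) → NormalizedAtEmpty l → IntersectingSupermodular l →
                      value l f + value l P ≤ value l split + value l merge
  value-split-merge l l∅≡0 supermodular = begin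
    value l f + value l P                    ≡⟨ cong₂ _+_ (sum-remove {i = a} (l ∘ block f)) value-P ⟩
    (l A + R) + (K + D)                      ≡⟨ ℤ+.interchange (l A) R K D ⟩
    (l A + K) + (R + D)                      ≤⟨ ℤP.+-monoˡ-≤ (R + D)
                                                    (uncross l supermodular A kept kept-disjoint kept-meets) ⟩
    (sum (λ i → l (A ∩ kept i)) + l W) + (R + D)
                                             ≡⟨ cong (λ s → (s + l W) + (R + D)) (sum-cong-≗ (cong l ∘ A∩kept)) ⟩
    (X + l W) + (R + D)                      ≡⟨ ℤ+.interchange X (l W) R D ⟩
    (X + R) + (l W + D)                      ≡⟨ cong (_+ (l W + D)) (ℤP.+-comm X R) ⟩
    (R + X) + (l W + D)                      ≡⟨ cong₂ _+_ value-split value-merge ⟨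
    value l split + value l merge            ∎
    where
    open ℤP.≤-Reasoning
    R K D X : ℤ
    R = sum (λ j → l (block f (punchIn a j)))
    K = sum (l ∘ kept)
    D = sum (l ∘ dropped)
    X = sum (λ i → l (A ∩ block P i))
    W : Subset n
    W = A ∪ ⋃ᶠ kept
    value-P : value l P ≡ K + D
    value-P = trans (sum-cong-≗ (sym ∘ l-kept+dropped l l∅≡0)) (∑-distrib-+ (l ∘ kept) (l ∘ dropped))
    value-split : value l split ≡ R + X
    value-split = trans (sum-↑ m (l ∘ block split))
                        (cong₂ _+_ (sum-cong-≗ (cong l ∘ block-split-↑ˡ)) (sum-cong-≗ (cong l ∘ block-split-↑ʳ)))
    value-merge : value l merge ≡ l W + D
    value-merge = cong₂ _+_ (cong l block-merge-zero) (sum-cong-≗ (cong l ∘ block-merge-suc))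

  separates-split-merge : ∀ e → separates split e ℕ.+ separates merge e ℕ.≤ separates f e ℕ.+ separates P e
  separates-split-merge e@(u , v) = bound (f u ≟ f v) (P u ≟ P v) (f u ≟ a)
    where
    open ℕP.≤-Reasoning
    bound : Dec (f u ≡ f v) → Dec (P u ≡ P v) → Dec (f u ≡ a) →
            separates split e ℕ.+ separates merge e ℕ.≤ separates f e ℕ.+ separates P e
    bound (yes fu≡fv) (yes Pu≡Pv) _ = begin
      separates split e ℕ.+ separates merge e  ≡⟨ cong₂ ℕ._+_ (separates-≡ split (split-≡ fu≡fv (λ _ → Pu≡Pv)))
                                                               (separates-≡ merge (cong mergeLabel Pu≡Pv)) ⟩
      0                                        ≤⟨ z≤n ⟩
      separates f e ℕ.+ separates P e          ∎
    bound (no fu≢fv) (yes Pu≡Pv) _ = begin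
      separates split e ℕ.+ separates merge e  ≡⟨ cong (separates split e ℕ.+_)
                                                      (separates-≡ merge (cong mergeLabel Pu≡Pv)) ⟩
      separates split e ℕ.+ 0                  ≤⟨ ℕP.+-monoˡ-≤ 0 (separates≤1 split e) ⟩
      1 ℕ.+ 0                                  ≡⟨ cong₂ ℕ._+_ (separates-≢ f fu≢fv) (separates-≡ P Pu≡Pv) ⟨
      separates f e ℕ.+ separates P e          ∎
    bound (no fu≢fv) (no Pu≢Pv) _ = begin
      separates split e ℕ.+ separates merge e  ≤⟨ ℕP.+-mono-≤ (separates≤1 split e) (separates≤1 merge e) ⟩
      1 ℕ.+ 1                                  ≡⟨ cong₂ ℕ._+_ (separates-≢ f fu≢fv) (separates-≢ P Pu≢Pv) ⟨
      separates f e ℕ.+ separates P e          ∎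
    bound (yes fu≡fv) (no Pu≢Pv) (yes fu≡a) = begin
      separates split e ℕ.+ separates merge e  ≡⟨ cong (separates split e ℕ.+_) (separates-≡ merge both-merged) ⟩
      separates split e ℕ.+ 0                  ≤⟨ ℕP.+-monoˡ-≤ 0 (separates≤1 split e) ⟩
      1 ℕ.+ 0                                  ≡⟨ cong₂ ℕ._+_ (separates-≡ f fu≡fv) (separates-≢ P Pu≢Pv) ⟨
      separates f e ℕ.+ separates P e          ∎
      where
      both-merged : merge u ≡ merge v
      both-merged = trans (mergeLabel-zero⁺ (meets-inside fu≡a))
                          (sym (mergeLabel-zero⁺ (meets-inside (trans (sym fu≡fv) fu≡a))))
    bound (yes fu≡fv) (no Pu≢Pv) (no fu≢a) = begin
      separates split e ℕ.+ separates merge e  ≡⟨ cong (ℕ._+ separates merge e)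
                                                   (separates-≡ split (split-≡ fu≡fv (flip contradiction fu≢a))) ⟩
      separates merge e                        ≤⟨ separates≤1 merge e ⟩
      1                                        ≡⟨ cong₂ ℕ._+_ (separates-≡ f fu≡fv) (separates-≢ P Pu≢Pv) ⟨
      separates f e ℕ.+ separates P e          ∎

  cut-split-merge : ∀ es → cut split es ℕ.+ cut merge es ℕ.≤ cut f es ℕ.+ cut P es
  cut-split-merge = cut-+-mono separates-split-merge

  cut≤cut-split : ∀ es → cut f es ℕ.≤ cut split es
  cut≤cut-split = cut-mono (λ (u , v) → separates-coarser f split split-≡⇒f-≡)

open SplitMerge using (split; merge; split-separates; value-split-merge; cut-split-merge; cut≤cut-split)

+-cancelʳ-≤ : ∀ {i j} k → i + k ≤ j + k → i ≤ j
+-cancelʳ-≤ {i} {j} k i+k≤j+k = subst₂ _≤_ (cancel i) (cancel j) (ℤP.+-monoˡ-≤ (- k) i+k≤j+k)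
  where
  cancel : ∀ x → x + k - k ≡ x
  cancel x = trans (ℤP.+-assoc x k (- k)) (trans (cong (_+_ x) (ℤP.+-inverseʳ k)) (ℤP.+-identityʳ x))

spend-budget : ∀ {N c c′} d → N ℕ.≤ c ℕ.+ suc d → c ℕ.< c′ → N ℕ.≤ c′ ℕ.+ d
spend-budget {N} {c} {c′} d budget c<c′ = begin
  N              ≤⟨ budget ⟩
  c ℕ.+ suc d    ≡⟨ ℕP.+-suc c d ⟩
  suc c ℕ.+ d    ≤⟨ ℕP.+-monoˡ-≤ d c<c′ ⟩
  c′ ℕ.+ d       ∎
  where open ℕP.≤-Reasoning

module Connected {n : ℕ} (H : Graph n) (l : SetFn n) (l∅≡0 : NormalizedAtEmpty l)
         (supermodular : IntersectingSupermodular l) (connected : PartitionConnected l H) where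

  E : List (Fin n × Fin n)
  E = edges H

  N : ℕ
  N = length E

  Tight : ∀ {m} → (Fin n → Fin m) → Set
  Tight f = + cut f E ≤ value l f - l ⊤

  tight-trivial : Tight trivial
  tight-trivial = subst₂ _≤_ (cong +_ (sym (cut-const zero E)))
                             (trans (sym (ℤP.+-inverseʳ (l ⊤))) (cong (_- l ⊤) (sym (value-trivial l))))
                             ℤP.≤-refl

  tight-split : ∀ {m k} (f : Fin n → Fin (suc m)) a (P : Fin n → Fin k) →
                Tight f → Tight P → Tight (split f a P)
  tight-split {m} {k} f a P tight-f tight-P = +-cancelʳ-≤ (+ cut M E) (begin
    + cut S E + + cut M E        ≡⟨ ℤP.pos-+ (cut S E) (cut M E) ⟨
    + (cut S E ℕ.+ cut M E)      ≤⟨ +≤+ (cut-split-merge f a P E) ⟩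
    + (cut f E ℕ.+ cut P E)      ≡⟨ ℤP.pos-+ (cut f E) (cut P E) ⟩
    + cut f E + + cut P E        ≤⟨ ℤP.+-mono-≤ tight-f tight-P ⟩
    (Vf - L) + (VP - L)          ≡⟨ regroup Vf VP L ⟩
    (Vf + VP) - (L + L)          ≤⟨ ℤP.+-monoˡ-≤ (- (L + L)) (value-split-merge f a P l l∅≡0 supermodular) ⟩
    (VS + VM) - (L + L)          ≡⟨ regroup VS VM L ⟨
    (VS - L) + (VM - L)          ≤⟨ ℤP.+-monoʳ-≤ (VS - L) (partitionConnected⇒value-⊤≤cut l H l∅≡0 connected M) ⟩
    (VS - L) + + cut M E         ∎)
    where
    open ℤP.≤-Reasoning
    S : Fin n → Fin (m ℕ.+ k)
    S = split f a P
    M : Fin n → Fin (suc k)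
    M = merge f a P
    L Vf VP VS VM : ℤ
    L = l ⊤
    Vf = value l f
    VP = value l P
    VS = value l S
    VM = value l M
    regroup : ∀ x y z → (x - z) + (y - z) ≡ (x + y) - (z + z)
    regroup = solve-∀

  module _ (i : Fin N) where

    x y : Fin n
    x = proj₁ (List.lookup E i)
    y = proj₂ (List.lookup E i)

    E−i : List (Fin n × Fin n)
    E−i = edges (deleteEdge H i)

    cut-deleteEdge : ∀ {m} (f : Fin n → Fin m) → cut f E ≡ separates f (x , y) ℕ.+ cut f E−i
    cut-deleteEdge f =
      trans (cut-removeAt f E i) (cong (λ es → separates f (x , y) ℕ.+ cut f es) (sym (edges-deleteEdge H i)))

    cut-internal : ∀ {m} (f : Fin n → Fin m) → f x ≡ f y → cut f E ≡ cut f E−i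
    cut-internal f fx≡fy = trans (cut-deleteEdge f) (cong (ℕ._+ cut f E−i) (separates-≡ f fx≡fy))

    internal⇒cut<N : ∀ {m} (f : Fin n → Fin m) → f x ≡ f y → cut f E ℕ.< N
    internal⇒cut<N f fx≡fy = begin-strict
      cut f E          ≡⟨ cut-internal f fx≡fy ⟩
      cut f E−i        ≤⟨ cut≤length f E−i ⟩
      length E−i       <⟨ ℕP.n<1+n (length E−i) ⟩
      suc (length E−i) ≡⟨ cong (suc ∘ length) (edges-deleteEdge H i) ⟩
      suc (length (List.removeAt E i)) ≡⟨ ListP.length-removeAt′ E i ⟨
      N                ∎
      where open ℕP.≤-Reasoning

    Violated : Partition n → Set
    Violated P = ¬ (sumℤ (map (λ j → l (partSet P j)) (allFin (k P))) - l ⊤ ≤ + eK (deleteEdge H i) P)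

    violated⇒tight-separating : ∀ P → Violated P → Tight (part P) × ¬ part P x ≡ part P y
    violated⇒tight-separating P violated = tight , separated
      where
      p : Fin n → Fin (k P)
      p = part P
      c : ℕ
      c = cut p E−i
      V-L : ℤ
      V-L = value l p - l ⊤
      c<V-L : + c < V-L
      c<V-L = ℤP.≰⇒> λ V-L≤c → violated (subst₂ (λ v c → v - l ⊤ ≤ + c)
        (sym (sumℤ-allFin (λ j → l (partSet P j)))) (sym (crossing≡cut P E−i)) V-L≤c)
      V-L≤cut : V-L ≤ + (separates p (x , y) ℕ.+ c)
      V-L≤cut = subst (λ c → V-L ≤ + c) (cut-deleteEdge p) (partitionConnected⇒value-⊤≤cut l H l∅≡0 connected p)
      separated : ¬ p x ≡ p y
      separated px≡py = ℤP.<⇒≱ c<V-L (subst (λ s → V-L ≤ + (s ℕ.+ c)) (separates-≡ p px≡py) V-L≤cut)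
      tight : Tight p
      tight = subst (λ c → + c ≤ V-L) (sym (trans (cut-deleteEdge p) (cong (ℕ._+ c) (separates-≢ p separated))))
                    (ℤP.i<j⇒suc[i]≤j c<V-L)

    refine : ∀ {m} (f : Fin n → Fin m) → f x ≡ f y → Tight f → ∀ P → Violated P →
             Σ ℕ λ m′ → Σ (Fin n → Fin m′) λ f′ → Tight f′ × cut f E ℕ.< cut f′ E
    refine {zero} f _ _ _ _ with f x
    ... | ()
    refine {suc m} f fx≡fy tight-f P violated with violated⇒tight-separating P violated
    ... | tight-P , separated = _ , f′ , tight-split f (f x) (part P) tight-f tight-P , (begin-strict
      cut f E                          ≡⟨ cut-internal f fx≡fy ⟩
      cut f E−i                        ≤⟨ cut≤cut-split f (f x) (part P) E−i ⟩
      cut f′ E−i                       <⟨ ℕP.n<1+n (cut f′ E−i) ⟩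
      1 ℕ.+ cut f′ E−i                 ≡⟨ cong (ℕ._+ cut f′ E−i) (separates-≢ f′ f′-separates) ⟨
      separates f′ (x , y) ℕ.+ cut f′ E−i  ≡⟨ cut-deleteEdge f′ ⟨
      cut f′ E                         ∎)
      where
      open ℕP.≤-Reasoning
      f′ : Fin n → Fin (m ℕ.+ k P)
      f′ = split f (f x) (part P)
      f′-separates : ¬ f′ x ≡ f′ y
      f′-separates = split-separates f (f x) (part P) refl (sym fx≡fy) separated

  module _ (subadditive : WeaklySubadditive l)
           (minimal : ∀ i → PartitionConnected l (deleteEdge H i) → ⊥) where

    edges≤ : ∀ d {m} (f : Fin n → Fin m) → N ℕ.≤ cut f E ℕ.+ d → Tight f →
             + N ≤ sumSingletons l ⊤ - l ⊤
    edges≤-internal : ∀ d {m} (f : Fin n → Fin m) → N ℕ.≤ cut f E ℕ.+ d → Tight f →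
                      ∀ i → f (x i) ≡ f (y i) → + N ≤ sumSingletons l ⊤ - l ⊤

    edges≤ d f budget tight with Any.any? (λ e → f (proj₁ e) ≟ f (proj₂ e)) E
    ... | yes internal = edges≤-internal d f budget tight (Any.index internal) (lookup-index internal)
    ... | no ¬internal = begin
      + N                      ≡⟨ cong +_ (cut-all-separated f (¬Any⇒All¬ E ¬internal)) ⟨
      + cut f E                ≤⟨ tight ⟩
      value l f - l ⊤          ≤⟨ ℤP.+-monoˡ-≤ (- l ⊤) (value≤sumSingletons l subadditive f) ⟩
      sumSingletons l ⊤ - l ⊤  ∎
      where open ℤP.≤-Reasoning

    edges≤-internal zero f budget tight i fx≡fy =
      contradiction (subst (N ℕ.≤_) (ℕP.+-identityʳ (cut f E)) budget) (ℕP.<⇒≱ (internal⇒cut<N i f fx≡fy))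
    -- Both goals are decidable, so it suffices to refute their negations: a partition violated
    -- by H − i would let refine cut more edges.
    edges≤-internal (suc d) f budget tight i fx≡fy =
      decidable-stable (+ N ℤP.≤? sumSingletons l ⊤ - l ⊤) λ N≰ →
        minimal i λ P → decidable-stable (_ ℤP.≤? _) λ violated →
          let _ , f′ , tight′ , grows = refine i f fx≡fy tight P violated
          in N≰ (edges≤ d f′ (spend-budget d budget grows) tight′)

  sumSingletons-⊤≤edges : sumSingletons l ⊤ - l ⊤ ≤ + N
  sumSingletons-⊤≤edges = subst₂ (λ v c → v - l ⊤ ≤ + c) (value-id l) (cut-all-separated id (loopless H))
                                 (partitionConnected⇒value-⊤≤cut l H l∅≡0 connected id)

mainTheorem16 : ∀ {n : ℕ} (H : Graph n) (l : SetFn n) →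
    NormalizedAtEmpty l → IntersectingSupermodular l → WeaklySubadditive l →
    MinimallyPartitionConnected l H →
    + length (edges H) ≡ sumSingletons l ⊤ - l ⊤
mainTheorem16 H l l∅≡0 supermodular subadditive (connected , minimal) =
  ℤP.≤-antisym (edges≤ subadditive minimal N trivial (ℕP.m≤n+m N (cut trivial E)) tight-trivial)
               sumSingletons-⊤≤edges
  where open Connected H l l∅≡0 supermodular connected
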